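{- For any poset $\mathbf{P}$ on at least 2 elements, \[RR(\mathbf{P},\mathbf{A}_2)=\dim_2(\mathbf{P})+m(\mathbf{P}).\]
   Context: The Boolean lattice $\mathbf{B}_N$ is the poset $(2^{[N]},\subseteq)$. A poset $\mathbf{Q}$ contains $\mathbf{P}$ as a subposet if there is an injection $\phi$ with $x\le_{\mathbf{P}} y$ iff $\phi(x)\le_{\mathbf{Q}}\phi(y)$. The 2-dimension $\dim_2(\mathbf{P})$ is the least $N$ such that $\mathbf{B}_N$ contains $\mathbf{P}$ as a subposet. A minimum element of $\mathbf{P}$ is an $x$ with $x\le z$ for all $z\in\mathbf{P}$, and a maximum element is a $y$ with $z\le y$ for all $z\in\mathbf{P}$; $m(\mathbf{P})\in\{0,1,2\}$ is the number of these extremal elements (minimum and maximum) that $\mathbf{P}$ has. $\mathbf{A}_2$ is the 2-element antichain. A colored copy is monochromatic if all its elements share a color, rainbow if distinct elements have distinct colors. $RR(\mathbf{P},\mathbf{Q})$ is the smallest $N$ such that every coloring (with any number of colors) of $\mathbf{B}_N$ contains a monochromatic subposet isomorphic to $\mathbf{P}$ or a rainbow subposet isomorphic to $\mathbf{Q}$. -}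

module Defs where

open import Data.Nat using (ℕ; zero; suc; _+_; _<_)
open import Data.Bool using (Bool; true; false; if_then_else_)
open import Data.Fin using (Fin)
open import Data.Fin.Subset using (Subset; _⊆_)
open import Data.Fin.Properties using (any?; all?)
open import Data.Product using (Σ; ∃; _×_; _,_)
open import Data.Sum using (_⊎_)
open import Relation.Nullary using (¬_; Dec; does)
open import Relation.Binary.PropositionalEquality using (_≡_; _≢_; refl)
open import Relation.Binary.Definitions using (Decidable)
open import Function.Bundles using (_⇔_)
open import Function.Definitions using (Injective)

record FinPoset : Set₁ where
  field
    size    : ℕ
    _≼_     : Fin size → Fin size → Set
    ≼-dec   : Decidable _≼_
    ≼-refl  : ∀ x → x ≼ x
    ≼-antisym : ∀ {x y} → x ≼ y → y ≼ x → x ≡ y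
    ≼-trans : ∀ {x y z} → x ≼ y → y ≼ z → x ≼ z

open FinPoset public

BN : ℕ → Set
BN N = Subset N

record Embedding (P : FinPoset) (N : ℕ) : Set where
  field
    φ     : Fin (size P) → BN N
    φ-inj : Injective _≡_ _≡_ φ
    φ-ord : ∀ x y → (_≼_ P x y) ⇔ (φ x ⊆ φ y)

open Embedding public

Contains : ℕ → FinPoset → Set
Contains N P = Embedding P N

IsDim2 : FinPoset → ℕ → Set
IsDim2 P d = Contains d P × (∀ M → M < d → ¬ Contains M P)

HasMin : FinPoset → Set
HasMin P = ∃ λ x → ∀ z → _≼_ P x z

HasMax : FinPoset → Set
HasMax P = ∃ λ y → ∀ z → _≼_ P z y

hasMin? : (P : FinPoset) → Dec (HasMin P)
hasMin? P = any? (λ x → all? (λ z → ≼-dec P x z))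

hasMax? : (P : FinPoset) → Dec (HasMax P)
hasMax? P = any? (λ y → all? (λ z → ≼-dec P z y))

m : FinPoset → ℕ
m P = (if does (hasMin? P) then 1 else 0) + (if does (hasMax? P) then 1 else 0)

A₂ : FinPoset
A₂ = record
  { size = 2
  ; _≼_ = _≡_
  ; ≼-dec = Data.Fin._≟_
  ; ≼-refl = λ _ → refl
  ; ≼-antisym = λ p _ → p
  ; ≼-trans = λ { refl refl → refl }
  }
  where import Data.Fin

-- Colorings of B_N (colors are natural numbers; B_N is finite, so this
-- covers colorings with any number of colors).
Coloring : ℕ → Set
Coloring N = BN N → ℕ

MonochromaticCopy : (P : FinPoset) {N : ℕ} → Coloring N → Set
MonochromaticCopy P {N} c =
  Σ (Embedding P N) λ e → ∀ x y → c (φ e x) ≡ c (φ e y)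

RainbowCopy : (Q : FinPoset) {N : ℕ} → Coloring N → Set
RainbowCopy Q {N} c =
  Σ (Embedding Q N) λ e → ∀ x y → x ≢ y → c (φ e x) ≢ c (φ e y)

RRProperty : FinPoset → FinPoset → ℕ → Set
RRProperty P Q N = (c : Coloring N) → MonochromaticCopy P c ⊎ RainbowCopy Q c

IsRR : FinPoset → FinPoset → ℕ → Set
IsRR P Q r = RRProperty P Q r × (∀ M → M < r → ¬ RRProperty P Q M)

{-# OPTIONS --safe #-}
-- P embeds into B_(dim₂ P + m P) with no element sent to ∅ or [N]: append a
-- coordinate that is always in (if P has a minimum) and one that is always
-- out (if P has a maximum). In any colouring such a copy is monochromatic or
-- contains two proper sets (neither ∅ nor [N]) of distinct colours, and these
-- always yield a rainbow antichain (if A ⊆ C, a singleton {j} with j ∉ C is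
-- incomparable to both). Conversely, colour ∅, [N] and all other sets by three
-- different colours. There is no rainbow antichain, and a monochromatic copy of
-- P consists of proper sets; the minimum's image then contains a coordinate
-- common to all images and the maximum's image misses one missed by all of
-- them, and deleting these coordinates embeds P into B_(N - m P).
module Submission where

open import Defs
open import Data.Bool using (if_then_else_; not)
open import Data.Bool.Properties using (T-≡)
open import Data.Empty using (⊥-elim)
open import Data.Fin using (Fin; zero; suc; punchIn; punchOut)
import Data.Fin as Fin
open import Data.Fin.Properties using (any?; all?; 0≢1+n; punchIn-punchOut; punchInᵢ≢i; punchOut-punchIn)
open import Data.Fin.Subset using (Subset; Side; inside; outside; _∈_; _∉_; _⊆_; ∁; ⁅_⁆; Nonempty; Empty)
open import Data.Fin.Subset.Properties
  using (_⊆?_; anySubset?; nonempty?; drop-∷-⊆; ⊆-reflexive; ⊆-antisym; Empty-unique;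
         x∈⁅x⁆; x∈⁅y⁆⇒x≡y; x∉p⇒x∈∁p; x∈∁p⇒x∉p; x∉∁p⇒x∈p)
open import Data.Nat using (ℕ; zero; suc; _≤_; _<_; _+_; s≤s; _≟_)
open import Data.Nat.Induction using (<-wellFounded)
open import Data.Nat.Properties using (anyUpTo?; +-identityʳ; +-comm; +-assoc; +-cancelʳ-<)
open import Data.Product using (Σ; ∃; _×_; _,_; proj₁; proj₂; swap)
open import Data.Sum using (_⊎_; inj₁; inj₂; map₂)
open import Data.Vec using (Vec; []; _∷_; _++_; lookup; tabulate; removeAt; here; there)
open import Data.Vec.Properties using (lookup∘tabulate; []=⇒lookup; lookup⇒[]=; removeAt-punchOut; map-++)
open import Function using (_∘_; id)
open import Function.Bundles using (_⇔_; mk⇔; Equivalence)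
open import Induction.WellFounded using (Acc; acc)
open import Relation.Nullary using (¬_; Dec; yes; no; does; ¬?)
open import Relation.Nullary.Decidable using (map′; _×-dec_; _→-dec_; decidable-stable; isYes; toWitness; fromWitness)
open import Relation.Binary.PropositionalEquality using (_≡_; _≢_; refl; sym; trans; cong; subst; module ≡-Reasoning)

open Equivalence using (to; from)

private
  variable
    n k N M : ℕ
    P : FinPoset

⇔-dec : {A B : Set} → Dec A → Dec B → Dec (A ⇔ B)
⇔-dec a? b? = map′ (λ (f , g) → mk⇔ f g) (λ a⇔b → to a⇔b , from a⇔b) ((a? →-dec b?) ×-dec (b? →-dec a?))

least : {Q : ℕ → Set} → (∀ n → Dec (Q n)) → Q n → Σ ℕ λ d → Q d × (∀ m → m < d → ¬ Q m)
least {n = n} {Q = Q} Q? q = go n q (<-wellFounded n)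
  where
  go : ∀ n → Q n → Acc _<_ n → Σ ℕ λ d → Q d × (∀ m → m < d → ¬ Q m)
  go n q (acc rs) with anyUpTo? Q? n
  ... | yes (k , k<n , qk) = go k qk (rs k<n)
  ... | no none = n , q , λ k k<n qk → none (k , k<n , qk)

Searchable : Set → Set₁
Searchable A = {R : A → Set} → (∀ a → Dec (R a)) → Dec (∃ R)

anyVec? : {A : Set} → Searchable A → ∀ k → Searchable (Vec A k)
anyVec? any?ᴬ zero R? = map′ ([] ,_) (λ { ([] , r) → r }) (R? [])
anyVec? any?ᴬ (suc k) R? =
  map′ (λ (a , v , r) → a ∷ v , r) (λ { (a ∷ v , r) → a , v , r })
       (any?ᴬ λ a → anyVec? any?ᴬ k (R? ∘ (a ∷_)))

Proper : Subset n → Set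
Proper p = Nonempty p × Nonempty (∁ p)

_∥_ : Subset n → Subset n → Set
p ∥ q = ¬ p ⊆ q × ¬ q ⊆ p

empty-⊆ : {p q : Subset n} → Empty p → p ⊆ q
empty-⊆ ¬ne x∈p = ⊥-elim (¬ne (_ , x∈p))

⊆-full : {p q : Subset n} → Empty (∁ q) → p ⊆ q
⊆-full {q = q} ¬co {x} _ = x∉∁p⇒x∈p λ x∈∁q → ¬co (x , x∈∁q)

∥⇒proper : {p q : Subset n} → p ∥ q → Proper p
∥⇒proper {p = p} (p⊈q , q⊈p) =
  decidable-stable (nonempty? p) (p⊈q ∘ empty-⊆) ,
  decidable-stable (nonempty? (∁ p)) (q⊈p ∘ ⊆-full)

⁅⁆-∥ : {p : Subset n} {i j : Fin n} → i ∈ p → j ∉ p → ⁅ j ⁆ ∥ p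
⁅⁆-∥ {p = p} {i} {j} i∈p j∉p =
  (λ j⊆p → j∉p (j⊆p (x∈⁅x⁆ j))) ,
  (λ p⊆j → j∉p (subst (_∈ p) (x∈⁅y⁆⇒x≡y j (p⊆j i∈p)) i∈p))

IsOrderEmbedding : (P : FinPoset) → (Fin (size P) → BN N) → Set
IsOrderEmbedding P φ = ∀ x y → _≼_ P x y ⇔ (φ x ⊆ φ y)

isOrderEmbedding? : (P : FinPoset) (φ : Fin (size P) → BN N) → Dec (IsOrderEmbedding P φ)
isOrderEmbedding? P φ = all? λ x → all? λ y → ⇔-dec (≼-dec P x y) (φ x ⊆? φ y)

toEmbedding : (P : FinPoset) (φ : Fin (size P) → BN N) → IsOrderEmbedding P φ → Embedding P N
toEmbedding P φ φ-ord = record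
  { φ     = φ
  ; φ-inj = λ {x} {y} φx≡φy →
      ≼-antisym P (from (φ-ord x y) (⊆-reflexive φx≡φy)) (from (φ-ord y x) (⊆-reflexive (sym φx≡φy)))
  ; φ-ord = φ-ord
  }

contains? : ∀ N P → Dec (Contains N P)
contains? N P = map′ (λ (v , ord) → toEmbedding P (lookup v) ord) (λ e → tabulate (φ e) , tabulated e)
  (anyVec? anySubset? (size P) (λ v → isOrderEmbedding? P (lookup v)))
  where
  tabulated : (e : Embedding P N) → IsOrderEmbedding P (lookup (tabulate (φ e)))
  tabulated e x y rewrite lookup∘tabulate (φ e) x | lookup∘tabulate (φ e) y = φ-ord e x y

↓ : (P : FinPoset) → Fin (size P) → BN (size P)
↓ P x = tabulate λ y → isYes (≼-dec P y x)

∈↓⇔≼ : (P : FinPoset) {x y : Fin (size P)} → y ∈ ↓ P x ⇔ _≼_ P y x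
∈↓⇔≼ P {x} {y} = mk⇔
  (λ y∈↓x → toWitness {a? = ≼-dec P y x} (from T-≡ (trans (sym (lookup∘tabulate _ y)) ([]=⇒lookup y∈↓x))))
  (λ y≼x → lookup⇒[]= y (↓ P x) (trans (lookup∘tabulate _ y) (to T-≡ (fromWitness y≼x))))

downsetEmbedding : (P : FinPoset) → Embedding P (size P)
downsetEmbedding P = toEmbedding P (↓ P) λ x y → mk⇔
  (λ x≼y {z} z∈↓x → from (∈↓⇔≼ P) (≼-trans P (to (∈↓⇔≼ P) z∈↓x) x≼y))
  (λ ↓x⊆↓y → to (∈↓⇔≼ P) (↓x⊆↓y (from (∈↓⇔≼ P) (≼-refl P x))))

dim₂ : (P : FinPoset) → ∃ (IsDim2 P)
dim₂ P = least (λ N → contains? N P) (downsetEmbedding P)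

++⁺-⊆ : {p q : Subset n} {s : Subset k} → p ⊆ q → p ++ s ⊆ q ++ s
++⁺-⊆ {p = []} {[]} _ = id
++⁺-⊆ {p = _ ∷ _} {_ ∷ _} p⊆q here with p⊆q here
... | here = here
++⁺-⊆ {p = _ ∷ _} {_ ∷ _} p⊆q (there x∈p++s) = there (++⁺-⊆ (drop-∷-⊆ p⊆q) x∈p++s)

++⁻-⊆ : {p q : Subset n} {s t : Subset k} → p ++ s ⊆ q ++ t → p ⊆ q
++⁻-⊆ {p = _ ∷ _} {_ ∷ _} sub here with sub here
... | here = here
++⁻-⊆ {p = _ ∷ _} {_ ∷ _} sub (there x∈p) = there (++⁻-⊆ (drop-∷-⊆ sub) x∈p)

Nonempty-++ : {p : Subset n} {s : Subset k} → Nonempty p ⊎ Nonempty s → Nonempty (p ++ s)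
Nonempty-++ {p = _ ∷ _} (inj₁ (zero , here)) = zero , here
Nonempty-++ {p = _ ∷ p} (inj₁ (suc x , there x∈p)) with Nonempty-++ {p = p} (inj₁ (x , x∈p))
... | y , y∈ = suc y , there y∈
Nonempty-++ {p = []} (inj₂ ne) = ne
Nonempty-++ {p = _ ∷ p} (inj₂ ne) with Nonempty-++ {p = p} (inj₂ ne)
... | y , y∈ = suc y , there y∈

Nonempty-∁-++ : {p : Subset n} {s : Subset k} → Nonempty (∁ p) ⊎ Nonempty (∁ s) → Nonempty (∁ (p ++ s))
Nonempty-∁-++ {p = p} {s} = subst Nonempty (sym (map-++ not p s)) ∘ Nonempty-++

appendEmbedding : Embedding P N → Subset k → Embedding P (N + k)
appendEmbedding {P = P} e s = toEmbedding P (λ x → φ e x ++ s) ord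
  where
  ord : IsOrderEmbedding P (λ x → φ e x ++ s)
  ord x y = mk⇔ (λ x≼y {z} → ++⁺-⊆ (to (φ-ord e x y) x≼y)) (λ sub → from (φ-ord e x y) (++⁻-⊆ sub))

ProperEmbedding : FinPoset → ℕ → Set
ProperEmbedding P N = Σ (Embedding P N) λ e → ∀ x → Proper (φ e x)

noMin⇒Nonempty : ¬ HasMin P → (e : Embedding P N) → ∀ x → Nonempty (φ e x)
noMin⇒Nonempty ¬min e x = decidable-stable (nonempty? (φ e x))
  λ ¬ne → ¬min (x , λ z → from (φ-ord e x z) (empty-⊆ ¬ne))

noMax⇒Nonempty-∁ : ¬ HasMax P → (e : Embedding P N) → ∀ x → Nonempty (∁ (φ e x))
noMax⇒Nonempty-∁ ¬max e x = decidable-stable (nonempty? (∁ (φ e x)))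
  λ ¬co → ¬max (x , λ z → from (φ-ord e z x) (⊆-full ¬co))

-- m P unfolds to bit (hasMin? P) + bit (hasMax? P).
bit : {A : Set} → Dec A → ℕ
bit a? = if does a? then 1 else 0

pad : {A : Set} (a? : Dec A) → Side → Subset (bit a?)
pad (yes _) side = side ∷ []
pad (no _)  _    = []

Nonempty-or-padded : (min? : Dec (HasMin P)) (e : Embedding P N) →
                     ∀ x → Nonempty (φ e x) ⊎ Nonempty (pad min? inside)
Nonempty-or-padded (yes _)   e x = inj₂ (zero , here)
Nonempty-or-padded (no ¬min) e x = inj₁ (noMin⇒Nonempty ¬min e x)

Nonempty-∁-or-padded : (max? : Dec (HasMax P)) (e : Embedding P N) →
                       ∀ x → Nonempty (∁ (φ e x)) ⊎ Nonempty (∁ (pad max? outside))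
Nonempty-∁-or-padded (yes _)   e x = inj₂ (zero , here)
Nonempty-∁-or-padded (no ¬max) e x = inj₁ (noMax⇒Nonempty-∁ ¬max e x)

properPadding : (min? : Dec (HasMin P)) (max? : Dec (HasMax P)) →
                Embedding P N → ProperEmbedding P (N + (bit min? + bit max?))
properPadding min? max? e = appendEmbedding e (pad min? inside ++ pad max? outside) , λ x →
  Nonempty-++ (map₂ (Nonempty-++ ∘ inj₁) (Nonempty-or-padded min? e x)) ,
  Nonempty-∁-++ (map₂ (Nonempty-∁-++ ∘ inj₂) (Nonempty-∁-or-padded max? e x))

antichainEmbedding : {p q : Subset n} → p ∥ q → Embedding A₂ n
antichainEmbedding {n = n} {p} {q} (p⊈q , q⊈p) = toEmbedding A₂ ψ ord
  where
  ψ : Fin 2 → Subset n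
  ψ zero       = p
  ψ (suc zero) = q
  ord : IsOrderEmbedding A₂ ψ
  ord zero       zero       = mk⇔ (λ _ {_} → id) (λ _ → refl)
  ord zero       (suc zero) = mk⇔ (λ ()) (⊥-elim ∘ p⊈q)
  ord (suc zero) zero       = mk⇔ (λ ()) (⊥-elim ∘ q⊈p)
  ord (suc zero) (suc zero) = mk⇔ (λ _ {_} → id) (λ _ → refl)

rainbowAntichain : (c : Coloring n) {p q : Subset n} → p ∥ q → c p ≢ c q → RainbowCopy A₂ c
rainbowAntichain {n} c p∥q cp≢cq = e , distinct
  where
  e : Embedding A₂ n
  e = antichainEmbedding p∥q
  distinct : ∀ x y → x ≢ y → c (φ e x) ≢ c (φ e y)
  distinct zero       zero       x≢x = ⊥-elim (x≢x refl)
  distinct zero       (suc zero) _   = cp≢cq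
  distinct (suc zero) zero       _   = cp≢cq ∘ sym
  distinct (suc zero) (suc zero) x≢x = ⊥-elim (x≢x refl)

rainbowChain : (c : Coloring n) {p q : Subset n} {i j : Fin n} →
               i ∈ p → j ∉ q → p ⊆ q → c p ≢ c q → RainbowCopy A₂ c
rainbowChain c {p} {j = j} i∈p j∉q p⊆q cp≢cq with c ⁅ j ⁆ ≟ c p
... | yes cj≡cp = rainbowAntichain c (⁅⁆-∥ (p⊆q i∈p) j∉q) (cp≢cq ∘ trans (sym cj≡cp))
... | no  cj≢cp = rainbowAntichain c (⁅⁆-∥ i∈p (j∉q ∘ p⊆q)) cj≢cp

rainbowProper : (c : Coloring n) {p q : Subset n} → Proper p → Proper q → c p ≢ c q → RainbowCopy A₂ c
rainbowProper c {p} {q} ((_ , i∈p) , (_ , j∈∁p)) ((_ , k∈q) , (_ , l∈∁q)) cp≢cq with p ⊆? q | q ⊆? p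
... | yes p⊆q | _       = rainbowChain c i∈p (x∈∁p⇒x∉p l∈∁q) p⊆q cp≢cq
... | no _    | yes q⊆p = rainbowChain c k∈q (x∈∁p⇒x∉p j∈∁p) q⊆p (cp≢cq ∘ sym)
... | no p⊈q  | no q⊈p  = rainbowAntichain c (p⊈q , q⊈p) cp≢cq

properEmbedding⇒RR : ProperEmbedding P N → RRProperty P A₂ N
properEmbedding⇒RR (e , proper-images) c with any? (λ x → any? (λ y → ¬? (c (φ e x) ≟ c (φ e y))))
... | yes (x , y , cx≢cy) = inj₂ (rainbowProper c (proper-images x) (proper-images y) cx≢cy)
... | no  ¬differ         = inj₁ (e , λ x y →
  decidable-stable (c (φ e x) ≟ c (φ e y)) λ cx≢cy → ¬differ (x , y , cx≢cy))

data Shape (p : Subset n) : Set where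
  empty  : Empty p → Shape p
  full   : Empty (∁ p) → Shape p
  proper : Proper p → Shape p

shape : (p : Subset n) → Shape p
shape p with nonempty? p | nonempty? (∁ p)
... | no  p≡∅ | _        = empty p≡∅
... | yes _   | no  ∁p≡∅ = full ∁p≡∅
... | yes p≠∅ | yes ∁p≠∅ = proper (p≠∅ , ∁p≠∅)

shapeIndex : {p : Subset n} → Shape p → ℕ
shapeIndex (empty _)  = 0
shapeIndex (full _)   = 1
shapeIndex (proper _) = 2

shapeColouring : Coloring N
shapeColouring p = shapeIndex (shape p)

shapeIndex-proper : {p : Subset n} (s : Shape p) → Proper p → shapeIndex s ≡ 2
shapeIndex-proper (empty p≡∅)  (p≠∅ , _)  = ⊥-elim (p≡∅ p≠∅)
shapeIndex-proper (full ∁p≡∅)  (_ , ∁p≠∅) = ⊥-elim (∁p≡∅ ∁p≠∅)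
shapeIndex-proper (proper _)   _          = refl

shapeIndex-≡ : {p q : Subset n} (s : Shape p) (t : Shape q) →
               shapeIndex s ≡ shapeIndex t → p ≡ q ⊎ Proper p × Proper q
shapeIndex-≡ (empty p≡∅)  (empty q≡∅)  _ = inj₁ (trans (Empty-unique p≡∅) (sym (Empty-unique q≡∅)))
shapeIndex-≡ (full ∁p≡∅)  (full ∁q≡∅)  _ = inj₁ (⊆-antisym (⊆-full ∁q≡∅) (⊆-full ∁p≡∅))
shapeIndex-≡ (proper p-proper) (proper q-proper) _ = inj₂ (p-proper , q-proper)
shapeIndex-≡ (empty _)  (full _)   ()
shapeIndex-≡ (empty _)  (proper _) ()
shapeIndex-≡ (full _)   (empty _)  ()
shapeIndex-≡ (full _)   (proper _) ()
shapeIndex-≡ (proper _) (empty _)  ()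
shapeIndex-≡ (proper _) (full _)   ()

shapeColouring-noRainbow : ¬ RainbowCopy A₂ (shapeColouring {N})
shapeColouring-noRainbow (e , distinct) = distinct zero (suc zero) 0≢1+n
  (trans (shapeIndex-proper (shape p) (∥⇒proper p∥q)) (sym (shapeIndex-proper (shape q) (∥⇒proper (swap p∥q)))))
  where
  p = φ e zero
  q = φ e (suc zero)
  p∥q : p ∥ q
  p∥q = (λ p⊆q → 0≢1+n (from (φ-ord e zero (suc zero)) p⊆q)) ,
        (λ q⊆p → 0≢1+n (sym (from (φ-ord e (suc zero) zero) q⊆p)))

shapeColouring-monochromatic⇒proper :
  {x₀ x₁ : Fin (size P)} → x₀ ≢ x₁ → (e : Embedding P N) →
  (∀ x y → shapeColouring (φ e x) ≡ shapeColouring (φ e y)) → ∀ z → Proper (φ e z)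
shapeColouring-monochromatic⇒proper {x₀ = x₀} {x₁} x₀≢x₁ e mono z
  with shapeIndex-≡ (shape (φ e x₀)) (shape (φ e x₁)) (mono x₀ x₁)
... | inj₁ φx₀≡φx₁           = ⊥-elim (x₀≢x₁ (φ-inj e φx₀≡φx₁))
... | inj₂ (φx₀-proper , _) with shapeIndex-≡ (shape (φ e z)) (shape (φ e x₀)) (mono z x₀)
...   | inj₁ φz≡φx₀          = subst Proper (sym φz≡φx₀) φx₀-proper
...   | inj₂ (φz-proper , _) = φz-proper

lookup-removeAt : {A : Set} (xs : Vec A (suc n)) (i : Fin (suc n)) (j : Fin n) →
                  lookup (removeAt xs i) j ≡ lookup xs (punchIn i j)
lookup-removeAt xs i j = begin
  lookup (removeAt xs i) j                                 ≡⟨ cong (lookup (removeAt xs i)) (sym (punchOut-punchIn i)) ⟩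
  lookup (removeAt xs i) (punchOut (punchInᵢ≢i i j ∘ sym)) ≡⟨ removeAt-punchOut xs (punchInᵢ≢i i j ∘ sym) ⟩
  lookup xs (punchIn i j)                                  ∎
  where open ≡-Reasoning

∈-removeAt⇔ : {p : Subset (suc n)} {i : Fin (suc n)} {j : Fin n} → j ∈ removeAt p i ⇔ punchIn i j ∈ p
∈-removeAt⇔ {p = p} {i} {j} = mk⇔
  (λ j∈ → lookup⇒[]= _ p (trans (sym (lookup-removeAt p i j)) ([]=⇒lookup j∈)))
  (λ j∈ → lookup⇒[]= j (removeAt p i) (trans (lookup-removeAt p i j) ([]=⇒lookup j∈)))

∈-removeAt-punchOut : {p : Subset (suc n)} {i j : Fin (suc n)} (i≢j : i ≢ j) → j ∈ p → punchOut i≢j ∈ removeAt p i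
∈-removeAt-punchOut {p = p} i≢j j∈p = from ∈-removeAt⇔ (subst (_∈ p) (sym (punchIn-punchOut i≢j)) j∈p)

removeAt⁺-⊆ : {p q : Subset (suc n)} {i : Fin (suc n)} → p ⊆ q → removeAt p i ⊆ removeAt q i
removeAt⁺-⊆ p⊆q j∈ = from ∈-removeAt⇔ (p⊆q (to ∈-removeAt⇔ j∈))

removeAt⁻-⊆ : {p q : Subset (suc n)} {i : Fin (suc n)} →
              (i ∈ p → i ∈ q) → removeAt p i ⊆ removeAt q i → p ⊆ q
removeAt⁻-⊆ {i = i} i∈p⇒i∈q sub {j} j∈p with i Fin.≟ j
... | yes refl = i∈p⇒i∈q j∈p
... | no  i≢j  = subst (_∈ _) (punchIn-punchOut i≢j) (to ∈-removeAt⇔ (sub (∈-removeAt-punchOut i≢j j∈p)))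

Nonempty-∁-removeAt : {p : Subset (suc n)} {i : Fin (suc n)} →
                      i ∈ p → Nonempty (∁ p) → Nonempty (∁ (removeAt p i))
Nonempty-∁-removeAt {p = p} {i} i∈p (j , j∈∁p) =
  punchOut i≢j , x∉p⇒x∈∁p (x∈∁p⇒x∉p j∈∁p ∘ subst (_∈ p) (punchIn-punchOut i≢j) ∘ to ∈-removeAt⇔)
  where
  i≢j : i ≢ j
  i≢j i≡j = x∈∁p⇒x∉p j∈∁p (subst (_∈ p) i≡j i∈p)

removeCoordinate : (e : Embedding P (suc N)) (i : Fin (suc N)) →
                   (∀ x y → i ∈ φ e x → i ∈ φ e y) → Embedding P N
removeCoordinate {P = P} e i constant = toEmbedding P (λ x → removeAt (φ e x) i) ord
  where
  ord : IsOrderEmbedding P (λ x → removeAt (φ e x) i)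
  ord x y = mk⇔ (λ x≼y {j} → removeAt⁺-⊆ (to (φ-ord e x y) x≼y))
                (λ sub → from (φ-ord e x y) (removeAt⁻-⊆ (constant x y) sub))

removeMinCoordinate : (min? : Dec (HasMin P)) (e : Embedding P M) → (∀ x → Proper (φ e x)) →
  Σ ℕ λ K → K + bit min? ≡ M × Σ (Embedding P K) λ e′ → ∀ x → Nonempty (∁ (φ e′ x))
removeMinCoordinate {M = M} (no _) e proper-images = M , +-identityʳ M , e , proj₂ ∘ proper-images
removeMinCoordinate {M = zero} (yes (x₀ , _)) e proper-images with proj₁ (proper-images x₀)
... | () , _
removeMinCoordinate {M = suc K} (yes (x₀ , x₀-min)) e proper-images =
  K , +-comm K 1 , removeCoordinate e i (λ _ y _ → i∈φ y) ,
  λ x → Nonempty-∁-removeAt (i∈φ x) (proj₂ (proper-images x))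
  where
  i : Fin (suc K)
  i = proj₁ (proj₁ (proper-images x₀))
  i∈φ : ∀ y → i ∈ φ e y
  i∈φ y = to (φ-ord e x₀ y) (x₀-min y) (proj₂ (proj₁ (proper-images x₀)))

removeMaxCoordinate : (max? : Dec (HasMax P)) (e : Embedding P M) → (∀ x → Nonempty (∁ (φ e x))) →
  Σ ℕ λ K → K + bit max? ≡ M × Embedding P K
removeMaxCoordinate {M = M} (no _) e _ = M , +-identityʳ M , e
removeMaxCoordinate {M = zero} (yes (y₀ , _)) e ∁-nonempty with ∁-nonempty y₀
... | () , _
removeMaxCoordinate {M = suc K} (yes (y₀ , y₀-max)) e ∁-nonempty =
  K , +-comm K 1 , removeCoordinate e j λ x _ j∈φx → ⊥-elim (j∉φy₀ (to (φ-ord e x y₀) (y₀-max x) j∈φx))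
  where
  j : Fin (suc K)
  j = proj₁ (∁-nonempty y₀)
  j∉φy₀ : j ∉ φ e y₀
  j∉φy₀ = x∈∁p⇒x∉p (proj₂ (∁-nonempty y₀))

removeExtremalCoordinates : (min? : Dec (HasMin P)) (max? : Dec (HasMax P)) →
  ProperEmbedding P M → Σ ℕ λ K → Embedding P K × K + (bit min? + bit max?) ≡ M
removeExtremalCoordinates {M = M} min? max? (e , proper-images)
  with removeMinCoordinate min? e proper-images
... | K₁ , K₁+a≡M , e₁ , ∁-nonempty with removeMaxCoordinate max? e₁ ∁-nonempty
... | K₂ , K₂+b≡K₁ , e₂ = K₂ , e₂ , (begin
  K₂ + (a + b) ≡⟨ cong (K₂ +_) (+-comm a b) ⟩
  K₂ + (b + a) ≡⟨ +-assoc K₂ b a ⟨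
  K₂ + b + a   ≡⟨ cong (_+ a) K₂+b≡K₁ ⟩
  K₁ + a       ≡⟨ K₁+a≡M ⟩
  M            ∎)
  where
  open ≡-Reasoning
  a = bit min?
  b = bit max?

distinctPair : 2 ≤ n → Σ (Fin n) λ x₀ → Σ (Fin n) λ x₁ → x₀ ≢ x₁
distinctPair (s≤s (s≤s _)) = zero , suc zero , 0≢1+n

RRProperty⇒Contains : (P : FinPoset) → 2 ≤ size P → RRProperty P A₂ M → Σ ℕ λ K → Contains K P × K + m P ≡ M
RRProperty⇒Contains P 2≤∣P∣ rr with rr shapeColouring
... | inj₂ rainbow = ⊥-elim (shapeColouring-noRainbow rainbow)
... | inj₁ (e , mono) with distinctPair 2≤∣P∣
... | _ , _ , x₀≢x₁ = removeExtremalCoordinates (hasMin? P) (hasMax? P)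
                        (e , shapeColouring-monochromatic⇒proper x₀≢x₁ e mono)

proposition1 : (P : FinPoset) → 2 ≤ size P →
    Σ ℕ (λ d → IsDim2 P d × IsRR P A₂ (d + m P))
proposition1 P 2≤∣P∣ with dim₂ P
... | d , embeds , minimal = d , (embeds , minimal) , upper , lower
  where
  upper : RRProperty P A₂ (d + m P)
  upper = properEmbedding⇒RR (properPadding (hasMin? P) (hasMax? P) embeds)
  lower : ∀ M → M < d + m P → ¬ RRProperty P A₂ M
  lower M M<d+m rr with RRProperty⇒Contains P 2≤∣P∣ rr
  ... | K , embedsK , K+m≡M =
    minimal K (+-cancelʳ-< (m P) K d (subst (_< d + m P) (sym K+m≡M) M<d+m)) embedsK
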